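{- For $n\ge 1$ and $i\ge 0$, let $\mathcal{C}_{(\geq,\geq)}(n,i)$ denote the set of Catalan words $w=w_1\cdots w_n$ of length $n$ that avoid the pattern $(\geq,\geq)$ and whose last letter is $w_n=i$. Define \[ C_i^{\geq}(x;p,q)=\sum_{n\geq 1}x^n \sum_{w\in \mathcal{C}_{(\geq, \geq)}(n,i)}p^{\mathrm{sper}(w)}q^{\mathrm{area}(w)},\qquad C^{\geq}(x;p,q;v)=\sum_{i \geq 0}C_i^{\geq}(x;p,q)v^{i}. \] Then $C^{\geq}(x;p,q;v)$ satisfies the functional equation \[ C^{\geq}(x;p,q;v)=p^2qx+p^3q^2x^2+\frac{p^3q^3x^2}{1-qv}C^{\geq}(x;p,q;q)+p^2 q^2xv\,C^{\geq}(x;p,q;qv)-\frac{p^3q^5 x^2v^2}{1-qv}C^{\geq}(x;p,q;q^2v). \]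
   Context: A Catalan word of length $n\ge 0$ is a sequence $w=w_1\cdots w_n$ of non-negative integers with $w_1=0$ and $0\le w_i\le w_{i-1}+1$ for $i=2,\dots,n$. It avoids the pattern $(\geq,\geq)$ if there is no index $i$ with $w_i\ge w_{i+1}\ge w_{i+2}$. To $w$ is associated the polyomino (bargraph) $P(w)$ with $n$ bottom-aligned columns, the $i$-th column consisting of $w_i+1$ unit cells. $\mathrm{area}(w)$ is the number of cells of $P(w)$, i.e. $\sum_{i=1}^n (w_i+1)$; $\mathrm{sper}(w)$ (the semiperimeter) is half the perimeter of $P(w)$, the perimeter being the number of cell edges of $P(w)$ not shared with another cell of $P(w)$. -}

module Defs where

open import Data.Bool using (Bool; true; false; _∧_; not; if_then_else_)
open import Data.Nat using (ℕ; zero; suc; _+_; _*_; _∸_; _⊓_; _≤ᵇ_; _≡ᵇ_; _/_)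
open import Data.List using (List; []; _∷_; map; concatMap; filter; length; upTo; foldr; head; last)
open import Data.Maybe using (Maybe; just; nothing)
open import Data.Integer using (ℤ; +_) renaming (_+_ to _+ℤ_; _-_ to _-ℤ_)
open import Relation.Nullary.Decidable using (¬?; yes; no)
open import Relation.Binary.PropositionalEquality using (_≡_)
open import Data.Bool.Properties using () renaming (_≟_ to _≟B_)
import Data.Nat as N

catStep : ℕ → List ℕ → Bool
catStep prev []       = true
catStep prev (w ∷ ws) = (w ≤ᵇ suc prev) ∧ catStep w ws

isCatalan : List ℕ → Bool
isCatalan []       = true
isCatalan (w ∷ ws) = (w ≡ᵇ 0) ∧ catStep w ws

avoidsGeGe : List ℕ → Bool
avoidsGeGe (a ∷ b ∷ c ∷ rest) = not ((b ≤ᵇ a) ∧ (c ≤ᵇ b)) ∧ avoidsGeGe (b ∷ c ∷ rest)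
avoidsGeGe _                  = true

lastIs : ℕ → List ℕ → Bool
lastIs i w with last w
... | just l  = l ≡ᵇ i
... | nothing = false

area : List ℕ → ℕ
area = foldr (λ w r → suc w + r) 0

-- Number of cells j ∈ {0..w} of a column of height w+1 whose side edge
-- (towards a neighbour column of letter l, if any) is not shared with a
-- cell of the neighbour column.
exposedSide : ℕ → Maybe ℕ → ℕ
exposedSide w nothing  = suc w
exposedSide w (just l) = length (filter (λ j → ¬? (j N.≤? l)) (upTo (suc w)))

-- perimeter: for each column, bottom edge + top edge (always exposed),
-- plus the exposed left and right side edges.
perimeterFrom : Maybe ℕ → List ℕ → ℕ
perimeterFrom prev []         = 0
perimeterFrom prev (w ∷ rest) =
  2 + exposedSide w prev + exposedSide w (head rest) + perimeterFrom (just w) rest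

perimeter : List ℕ → ℕ
perimeter = perimeterFrom nothing

sper : List ℕ → ℕ
sper w = perimeter w / 2

listsOf : ℕ → ℕ → List (List ℕ)
listsOf zero    b = [] ∷ []
listsOf (suc k) b = concatMap (λ x → map (x ∷_) (listsOf k b)) (upTo b)

-- every Catalan word of length n has entries ≤ n-1 < n, so this lists
-- exactly C_(≥,≥)(n,i)
CWords : ℕ → ℕ → List (List ℕ)
CWords n i = filter (λ w → (isCatalan w ∧ avoidsGeGe w ∧ lastIs i w) ≟B true) (listsOf n n)

-- Formal power series in x, p, q, v with integer coefficients:
-- F n s a c = coefficient of x^n p^s q^a v^c.

FPS : Set
FPS = ℕ → ℕ → ℕ → ℕ → ℤ

sumℤ : List ℤ → ℤ
sumℤ = foldr _+ℤ_ (+ 0)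

_⊕_ : FPS → FPS → FPS
(f ⊕ g) n s a c = f n s a c +ℤ g n s a c

_⊖_ : FPS → FPS → FPS
(f ⊖ g) n s a c = f n s a c -ℤ g n s a c

infixl 6 _⊕_ _⊖_

mon : ℕ → ℕ → ℕ → ℕ → FPS → FPS
mon dx dp dq dv f n s a c =
  if (dx ≤ᵇ n) ∧ (dp ≤ᵇ s) ∧ (dq ≤ᵇ a) ∧ (dv ≤ᵇ c)
  then f (n ∸ dx) (s ∸ dp) (a ∸ dq) (c ∸ dv)
  else + 0

oneS : FPS
oneS n s a c = if (n ≡ᵇ 0) ∧ (s ≡ᵇ 0) ∧ (a ≡ᵇ 0) ∧ (c ≡ᵇ 0) then + 1 else + 0

monomial : ℕ → ℕ → ℕ → ℕ → FPS
monomial dx dp dq dv = mon dx dp dq dv oneS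

-- multiplication by 1/(1 - q v) = Σ_k q^k v^k
divOneMinusQV : FPS → FPS
divOneMinusQV f n s a c = sumℤ (map (λ k → f n s (a ∸ k) (c ∸ k)) (upTo (suc (a ⊓ c))))

Ci : ℕ → ℕ → ℕ → ℕ → ℤ
Ci i n s a = + length (filter (λ w → ((sper w ≡ᵇ s) ∧ (area w ≡ᵇ a)) ≟B true) (CWords n i))

Cgf : FPS
Cgf n s a c = Ci c n s a

-- C^≥(x;p,q;q^j v) = Σ_i C_i^≥ q^(j i) v^i
CgfAtQjV : ℕ → FPS
CgfAtQjV j n s a c = if (j * c ≤ᵇ a) then Ci c n s (a ∸ j * c) else + 0

-- C^≥(x;p,q;q) = Σ_i C_i^≥ q^i   (no v)
CgfAtQ : FPS
CgfAtQ n s a c =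
  if c ≡ᵇ 0 then sumℤ (map (λ i → Ci i n s (a ∸ i)) (upTo (suc a))) else + 0

{-# OPTIONS --safe #-}
module Submission where

-- Cut an avoider (a Catalan word avoiding (≥,≥)) of length ≥ 3 before its last letter x. The
-- prefix u is an avoider; if its weight is p^σ q^α v^L, then u x is an avoider iff x = L + 1, or
-- x ≤ L and u ends with an ascent, which in a Catalan word means that u ends with L - 1, L. So every
-- avoider of length ≥ 3 is either u (L + 1), of weight p² q² v · p^σ q^α (qv)^L, which gives the
-- term x p² q² v C(qv), or u (L + 1) x with x ≤ L + 1, of weight p³ q³ · p^σ q^α q^L · (qv)^x.
-- Summing Σ_{x ≤ L+1} (qv)^x = (1 - (qv)^(L+2))/(1 - qv) gives the two terms with denominator
-- 1 - qv. The words 0, 00 and 01 account for the remaining terms. Both sides are compared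
-- coefficient by coefficient, each coefficient being a finite sum over avoiders.

open import Defs
open import Algebra.Bundles using (CommutativeMonoid)
open import Data.Bool using (Bool; true; false; _∧_; not; if_then_else_; T)
open import Data.Bool.Properties using (∧-assoc; ∧-identityʳ; ∧-zeroʳ; ∧-commutativeMonoid; T-∧)
  renaming (_≟_ to _≟B_)
open import Data.Integer as ℤ using (ℤ)
open import Data.Integer.Properties using (pos-+)
import Data.Integer.Solver
open import Data.List using (List; []; _∷_; _++_; _∷ʳ_; map; concatMap; filter; length; upTo)
open import Data.List.Properties using (applyUpTo-∷ʳ)
open import Data.Maybe using (just; nothing)
open import Data.Nat
open import Data.Nat.DivMod using (+-distrib-/-∣ʳ; m*n/n≡m)
open import Data.Nat.Divisibility using (divides-refl)
open import Data.Nat.Properties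
open import Data.Nat.Solver using (module +-*-Solver)
open import Data.Product using (_,_)
open import Data.Sum using (inj₁; inj₂)
open import Data.Unit using (tt)
open import Function.Bundles using (Equivalence)
open import Relation.Binary.PropositionalEquality
open import Relation.Nullary using (yes; no; does; Dec)
open import Relation.Nullary.Decidable using (¬?)
open import Relation.Nullary.Negation using (contradiction)
open import Relation.Nullary.Reflects using (Reflects; ofʸ; ofⁿ; fromEquivalence)

open import Algebra.Properties.CommutativeSemigroup +-commutativeSemigroup using (interchange)
open import Algebra.Properties.CommutativeSemigroup *-commutativeSemigroup
  using () renaming (x∙yz≈y∙xz to x*[y*z]≡y*[x*z])
open import Algebra.Properties.CommutativeSemigroup (CommutativeMonoid.commutativeSemigroup ∧-commutativeMonoid)
  using () renaming (interchange to ∧-interchange)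
open +-*-Solver using (solve; _:+_; _:*_; _:=_; con)
module ℤ-Solver = Data.Integer.Solver.+-*-Solver

∑∈ : {A : Set} → List A → (A → ℕ) → ℕ
∑∈ []       f = 0
∑∈ (x ∷ xs) f = f x + ∑∈ xs f

syntax ∑∈ xs (λ x → e) = ∑[ x ∈ xs ] e

∑< : ℕ → (ℕ → ℕ) → ℕ
∑< zero    f = 0
∑< (suc n) f = ∑< n f + f n

syntax ∑< n (λ i → e) = ∑[ i < n ] e

private
  variable
    A B : Set

∑∈-cong : ∀ xs {f g : A → ℕ} → (∀ x → f x ≡ g x) → ∑∈ xs f ≡ ∑∈ xs g
∑∈-cong []       f≗g = refl
∑∈-cong (x ∷ xs) f≗g = cong₂ _+_ (f≗g x) (∑∈-cong xs f≗g)

∑∈-++ : ∀ xs ys (f : A → ℕ) → ∑∈ (xs ++ ys) f ≡ ∑∈ xs f + ∑∈ ys f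
∑∈-++ []       ys f = refl
∑∈-++ (x ∷ xs) ys f = trans (cong (f x +_) (∑∈-++ xs ys f)) (sym (+-assoc (f x) _ _))

∑∈-+ : ∀ xs (f g : A → ℕ) → ∑[ x ∈ xs ] (f x + g x) ≡ ∑∈ xs f + ∑∈ xs g
∑∈-+ []       f g = refl
∑∈-+ (x ∷ xs) f g = trans (cong (f x + g x +_) (∑∈-+ xs f g)) (interchange (f x) (g x) _ _)

∑∈-*ˡ : ∀ xs k (f : A → ℕ) → ∑[ x ∈ xs ] (k * f x) ≡ k * ∑∈ xs f
∑∈-*ˡ []       k f = sym (*-zeroʳ k)
∑∈-*ˡ (x ∷ xs) k f = trans (cong (k * f x +_) (∑∈-*ˡ xs k f)) (sym (*-distribˡ-+ k (f x) _))

∑∈-concatMap : ∀ (h : A → List B) xs (f : B → ℕ) →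
               ∑∈ (concatMap h xs) f ≡ ∑[ x ∈ xs ] ∑∈ (h x) f
∑∈-concatMap h []       f = refl
∑∈-concatMap h (x ∷ xs) f =
  trans (∑∈-++ (h x) (concatMap h xs) f) (cong (∑∈ (h x) f +_) (∑∈-concatMap h xs f))

∑∈-map : ∀ (h : A → B) xs (f : B → ℕ) → ∑∈ (map h xs) f ≡ ∑[ x ∈ xs ] f (h x)
∑∈-map h []       f = refl
∑∈-map h (x ∷ xs) f = cong (f (h x) +_) (∑∈-map h xs f)

∑<-cong : ∀ n {f g : ℕ → ℕ} → (∀ i → i < n → f i ≡ g i) → ∑< n f ≡ ∑< n g
∑<-cong zero    f≗g = refl
∑<-cong (suc n) f≗g = cong₂ _+_ (∑<-cong n (λ i i<n → f≗g i (m<n⇒m<1+n i<n))) (f≗g n ≤-refl)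

∑<-+ : ∀ n (f g : ℕ → ℕ) → ∑[ i < n ] (f i + g i) ≡ ∑< n f + ∑< n g
∑<-+ zero    f g = refl
∑<-+ (suc n) f g = trans (cong (_+ (f n + g n)) (∑<-+ n f g)) (interchange (∑< n f) (∑< n g) (f n) (g n))

∑<-*ˡ : ∀ n k (f : ℕ → ℕ) → ∑[ i < n ] (k * f i) ≡ k * ∑< n f
∑<-*ˡ zero    k f = sym (*-zeroʳ k)
∑<-*ˡ (suc n) k f = trans (cong (_+ k * f n) (∑<-*ˡ n k f)) (sym (*-distribˡ-+ k _ (f n)))

∑<-zero : ∀ n (f : ℕ → ℕ) → (∀ i → i < n → f i ≡ 0) → ∑< n f ≡ 0
∑<-zero zero    f f≡0 = refl
∑<-zero (suc n) f f≡0 = cong₂ _+_ (∑<-zero n f (λ i i<n → f≡0 i (m<n⇒m<1+n i<n))) (f≡0 n ≤-refl)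

∑<-+-split : ∀ m n (f : ℕ → ℕ) → ∑< (m + n) f ≡ ∑< m f + ∑[ i < n ] f (m + i)
∑<-+-split m zero    f = trans (cong (λ k → ∑< k f) (+-identityʳ m)) (sym (+-identityʳ _))
∑<-+-split m (suc n) f = begin
  ∑< (m + suc n) f                              ≡⟨ cong (λ k → ∑< k f) (+-suc m n) ⟩
  ∑< (m + n) f + f (m + n)                      ≡⟨ cong (_+ f (m + n)) (∑<-+-split m n f) ⟩
  ∑< m f + ∑[ i < n ] f (m + i) + f (m + n)     ≡⟨ +-assoc (∑< m f) _ _ ⟩
  ∑< m f + ∑[ i < suc n ] f (m + i)             ∎
  where open ≡-Reasoning

∑<-support : ∀ {n N} (f : ℕ → ℕ) → n ≤ N → (∀ i → n ≤ i → f i ≡ 0) → ∑< N f ≡ ∑< n f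
∑<-support {n} {N} f n≤N f≡0 = begin
  ∑< N f                               ≡⟨ cong (λ k → ∑< k f) (m+[n∸m]≡n n≤N) ⟨
  ∑< (n + (N ∸ n)) f                   ≡⟨ ∑<-+-split n (N ∸ n) f ⟩
  ∑< n f + ∑[ i < N ∸ n ] f (n + i)    ≡⟨ cong (∑< n f +_) (∑<-zero (N ∸ n) _ (λ i _ → f≡0 (n + i) (m≤m+n n i))) ⟩
  ∑< n f + 0                           ≡⟨ +-identityʳ _ ⟩
  ∑< n f                               ∎
  where open ≡-Reasoning

∑<-upTo : ∀ n (f : ℕ → ℕ) → ∑∈ (upTo n) f ≡ ∑< n f
∑<-upTo zero    f = refl
∑<-upTo (suc n) f = begin
  ∑∈ (upTo (suc n)) f            ≡⟨ cong (λ xs → ∑∈ xs f) (sym (applyUpTo-∷ʳ (λ i → i) n)) ⟩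
  ∑∈ (upTo n ∷ʳ n) f             ≡⟨ ∑∈-++ (upTo n) (n ∷ []) f ⟩
  ∑∈ (upTo n) f + (f n + 0)      ≡⟨ cong₂ _+_ (∑<-upTo n f) (+-identityʳ (f n)) ⟩
  ∑< n f + f n                   ∎
  where open ≡-Reasoning

∑<-∑∈-comm : ∀ n xs (F : ℕ → A → ℕ) →
             ∑[ i < n ] ∑∈ xs (F i) ≡ ∑[ x ∈ xs ] ∑[ i < n ] F i x
∑<-∑∈-comm n []       F = ∑<-zero n (λ _ → 0) (λ _ _ → refl)
∑<-∑∈-comm n (x ∷ xs) F =
  trans (∑<-+ n (λ i → F i x) (λ i → ∑∈ xs (F i))) (cong (∑< n (λ i → F i x) +_) (∑<-∑∈-comm n xs F))

ind : Bool → ℕ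
ind b = if b then 1 else 0

ind-∧ : ∀ x y → ind (x ∧ y) ≡ ind x * ind y
ind-∧ true  y = sym (+-identityʳ (ind y))
ind-∧ false y = refl

ind-guard : ∀ x {m n} → (T x → m ≡ n) → ind x * m ≡ ind x * n
ind-guard true  m≡n = cong (1 *_) (m≡n tt)
ind-guard false m≡n = refl

≤ᵇ-true : ∀ {m n} → m ≤ n → (m ≤ᵇ n) ≡ true
≤ᵇ-true {m} {n} m≤n with m ≤ᵇ n | ≤ᵇ-reflects-≤ m n
... | true  | _        = refl
... | false | ofⁿ m≰n = contradiction m≤n m≰n

≤ᵇ-false : ∀ {m n} → n < m → (m ≤ᵇ n) ≡ false
≤ᵇ-false {m} {n} n<m with m ≤ᵇ n | ≤ᵇ-reflects-≤ m n
... | true  | ofʸ m≤n = contradiction m≤n (<⇒≱ n<m)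
... | false | _       = refl

does-≟true : ∀ b → does (b ≟B true) ≡ b
does-≟true true  = refl
does-≟true false = refl

length-filter : ∀ {P : A → Set} (P? : ∀ x → Dec (P x)) xs → length (filter P? xs) ≡ ∑[ x ∈ xs ] ind (does (P? x))
length-filter P? []       = refl
length-filter P? (x ∷ xs) with does (P? x)
... | true  = cong suc (length-filter P? xs)
... | false = length-filter P? xs

∑∈-filter : ∀ {P : A → Set} (P? : ∀ x → Dec (P x)) xs (f : A → ℕ) →
            ∑∈ (filter P? xs) f ≡ ∑[ x ∈ xs ] (ind (does (P? x)) * f x)
∑∈-filter P? []       f = refl
∑∈-filter P? (x ∷ xs) f with does (P? x)
... | true  = cong₂ _+_ (sym (+-identityʳ (f x))) (∑∈-filter P? xs f)
... | false = ∑∈-filter P? xs f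

δ : ℕ → ℕ → ℕ
δ m n = ind (m ≡ᵇ n)

≡ᵇ-reflects-≡ : ∀ m n → Reflects (m ≡ n) (m ≡ᵇ n)
≡ᵇ-reflects-≡ m n = fromEquivalence (≡ᵇ⇒≡ m n) (≡⇒≡ᵇ m n)

δ-refl : ∀ m → δ m m ≡ 1
δ-refl zero    = refl
δ-refl (suc m) = δ-refl m

δ-≢ : ∀ {m n} → m ≢ n → δ m n ≡ 0
δ-≢ {m} {n} m≢n with m ≡ᵇ n | ≡ᵇ-reflects-≡ m n
... | true  | ofʸ m≡n = contradiction m≡n m≢n
... | false | _       = refl

δ-> : ∀ {m n} → n < m → δ m n ≡ 0
δ-> n<m = δ-≢ (λ m≡n → <-irrefl (sym m≡n) n<m)

δ-sym : ∀ m n → δ m n ≡ δ n m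
δ-sym zero    zero    = refl
δ-sym zero    (suc n) = refl
δ-sym (suc m) zero    = refl
δ-sym (suc m) (suc n) = δ-sym m n

δ-subst : ∀ m n (f : ℕ → ℕ) → δ m n * f n ≡ δ m n * f m
δ-subst m n f with m ≡ᵇ n | ≡ᵇ-reflects-≡ m n
... | true  | ofʸ refl = refl
... | false | _        = refl

δ-+ˡ : ∀ d m n → δ (d + m) (d + n) ≡ δ m n
δ-+ˡ zero    m n = refl
δ-+ˡ (suc d) m n = δ-+ˡ d m n

δ-∸ : ∀ {d n} m → d ≤ n → δ m (n ∸ d) ≡ δ (d + m) n
δ-∸ {d} {n} m d≤n = begin
  δ m (n ∸ d)             ≡⟨ δ-+ˡ d m (n ∸ d) ⟨
  δ (d + m) (d + (n ∸ d)) ≡⟨ cong (δ (d + m)) (m+[n∸m]≡n d≤n) ⟩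
  δ (d + m) n             ∎
  where open ≡-Reasoning

δ-shift : ∀ d m n → ind (d ≤ᵇ n) * δ m (n ∸ d) ≡ δ (d + m) n
δ-shift d m n with d ≤ᵇ n | ≤ᵇ-reflects-≤ d n
... | true  | ofʸ d≤n = trans (+-identityʳ _) (δ-∸ m d≤n)
... | false | ofⁿ d≰n = sym (δ-> (<-≤-trans (≰⇒> d≰n) (m≤m+n d m)))

∑<-δ : ∀ N j (f : ℕ → ℕ) → j < N → ∑[ i < N ] (f i * δ j i) ≡ f j
∑<-δ N j f j<N = begin
  ∑[ i < N ] (f i * δ j i)
    ≡⟨ ∑<-support _ j<N (λ i j<i → elsewhere i (<⇒≢ j<i)) ⟩
  ∑[ i < j ] (f i * δ j i) + f j * δ j j
    ≡⟨ cong₂ _+_ (∑<-zero j _ (λ i i<j → elsewhere i (≢-sym (<⇒≢ i<j)))) (cong (f j *_) (δ-refl j)) ⟩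
  f j * 1
    ≡⟨ *-identityʳ (f j) ⟩
  f j
    ∎
  where
  open ≡-Reasoning
  elsewhere : ∀ i → j ≢ i → f i * δ j i ≡ 0
  elsewhere i j≢i = trans (cong (f i *_) (δ-≢ j≢i)) (*-zeroʳ (f i))

∑<-antidiagonal : ∀ σ α L s a → ∑[ i < suc a ] (δ σ s * δ α (a ∸ i) * δ L i) ≡ δ σ s * δ (L + α) a
∑<-antidiagonal σ α L s a with L ≤? a
... | yes L≤a = trans (∑<-δ (suc a) L (λ i → δ σ s * δ α (a ∸ i)) (s≤s L≤a)) (cong (δ σ s *_) (δ-∸ α L≤a))
... | no  L≰a = begin
  ∑[ i < suc a ] (δ σ s * δ α (a ∸ i) * δ L i)  ≡⟨ ∑<-zero (suc a) _ vanish ⟩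
  0                                             ≡⟨ *-zeroʳ (δ σ s) ⟨
  δ σ s * 0                                     ≡⟨ cong (δ σ s *_) (δ-> (<-≤-trans (≰⇒> L≰a) (m≤m+n L α))) ⟨
  δ σ s * δ (L + α) a                           ∎
  where
  open ≡-Reasoning
  vanish : ∀ i → i < suc a → δ σ s * δ α (a ∸ i) * δ L i ≡ 0
  vanish i i≤a = trans (cong (δ σ s * δ α (a ∸ i) *_) (δ-≢ L≢i)) (*-zeroʳ (δ σ s * δ α (a ∸ i)))
    where
    L≢i : L ≢ i
    L≢i refl = L≰a (s≤s⁻¹ i≤a)

-- F s a c is the coefficient of pˢ qᵃ vᶜ.
Coeffs : Set
Coeffs = ℕ → ℕ → ℕ → ℕ

mono : ℕ → ℕ → ℕ → Coeffs
mono σ α γ s a c = δ σ s * δ α a * δ γ c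

-- Multiplication by p^dp q^dq v^dv, and by 1/(1 - qv) = Σₖ (qv)ᵏ.
shiftBy : ℕ → ℕ → ℕ → Coeffs → Coeffs
shiftBy dp dq dv F s a c =
  ind ((dp ≤ᵇ s) ∧ (dq ≤ᵇ a) ∧ (dv ≤ᵇ c)) * F (s ∸ dp) (a ∸ dq) (c ∸ dv)

geomQV : Coeffs → Coeffs
geomQV F s a c = ∑[ k < suc (a ⊓ c) ] F s (a ∸ k) (c ∸ k)

mono-cong : ∀ {σ σ′ α α′ γ γ′} → σ ≡ σ′ → α ≡ α′ → γ ≡ γ′ → mono σ α γ ≡ mono σ′ α′ γ′
mono-cong refl refl refl = refl

shiftBy-mono : ∀ dp dq dv σ α γ s a c →
               shiftBy dp dq dv (mono σ α γ) s a c ≡ mono (dp + σ) (dq + α) (dv + γ) s a c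
shiftBy-mono dp dq dv σ α γ s a c = begin
  ind (P ∧ Q ∧ V) * (δ σ (s ∸ dp) * δ α (a ∸ dq) * δ γ (c ∸ dv))
    ≡⟨ cong (_* (δ σ (s ∸ dp) * δ α (a ∸ dq) * δ γ (c ∸ dv)))
            (trans (ind-∧ P (Q ∧ V)) (cong (ind P *_) (ind-∧ Q V))) ⟩
  ind P * (ind Q * ind V) * (δ σ (s ∸ dp) * δ α (a ∸ dq) * δ γ (c ∸ dv))
    ≡⟨ regroup (ind P) (ind Q) (ind V) (δ σ (s ∸ dp)) (δ α (a ∸ dq)) (δ γ (c ∸ dv)) ⟩
  ind P * δ σ (s ∸ dp) * (ind Q * δ α (a ∸ dq)) * (ind V * δ γ (c ∸ dv))
    ≡⟨ cong₂ _*_ (cong₂ _*_ (δ-shift dp σ s) (δ-shift dq α a)) (δ-shift dv γ c) ⟩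
  δ (dp + σ) s * δ (dq + α) a * δ (dv + γ) c
    ∎
  where
  open ≡-Reasoning
  P = dp ≤ᵇ s
  Q = dq ≤ᵇ a
  V = dv ≤ᵇ c
  regroup : ∀ x y z u v w → x * (y * z) * (u * v * w) ≡ x * u * (y * v) * (z * w)
  regroup = solve 6 (λ x y z u v w → x :* (y :* z) :* (u :* v :* w) := x :* u :* (y :* v) :* (z :* w)) refl

geomQV-mono : ∀ σ β γ s a c →
              geomQV (mono σ β γ) s a c ≡ ∑[ k < suc (a ⊓ c) ] mono σ (k + β) (k + γ) s a c
geomQV-mono σ β γ s a c = ∑<-cong (suc (a ⊓ c)) term
  where
  term : ∀ k → k < suc (a ⊓ c) → mono σ β γ s (a ∸ k) (c ∸ k) ≡ mono σ (k + β) (k + γ) s a c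
  term k k<1+a⊓c = cong₂ (λ x y → δ σ s * x * y)
    (δ-∸ β (≤-trans k≤a⊓c (m⊓n≤m a c))) (δ-∸ γ (≤-trans k≤a⊓c (m⊓n≤n a c)))
    where k≤a⊓c = s≤s⁻¹ k<1+a⊓c

mono-beyond : ∀ σ β γ s a c k → suc (a ⊓ c) ≤ k → mono σ (k + β) (k + γ) s a c ≡ 0
mono-beyond σ β γ s a c k a⊓c<k with a <? k
... | yes a<k = begin
  δ σ s * δ (k + β) a * δ (k + γ) c  ≡⟨ cong (λ x → δ σ s * x * δ (k + γ) c) (δ-> (<-≤-trans a<k (m≤m+n k β))) ⟩
  δ σ s * 0 * δ (k + γ) c            ≡⟨ cong (_* δ (k + γ) c) (*-zeroʳ (δ σ s)) ⟩
  0                                  ∎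
  where open ≡-Reasoning
... | no  a≮k = trans (cong (δ σ s * δ (k + β) a *_) (δ-> (<-≤-trans c<k (m≤m+n k γ)))) (*-zeroʳ (δ σ s * δ (k + β) a))
  where
  c<k : c < k
  c<k = ≰⇒> (λ k≤c → <⇒≱ a⊓c<k (⊓-glb (≮⇒≥ a≮k) k≤c))

geomQV-mono-split : ∀ m σ β γ s a c →
  geomQV (mono σ β γ) s a c ≡
  ∑[ x < m ] mono σ (x + β) (x + γ) s a c + geomQV (mono σ (m + β) (m + γ)) s a c
geomQV-mono-split m σ β γ s a c = begin
  geomQV (mono σ β γ) s a c                    ≡⟨ geomQV-mono σ β γ s a c ⟩
  ∑< N f                                       ≡⟨ ∑<-support f (m≤n+m N m) (mono-beyond σ β γ s a c) ⟨
  ∑< (m + N) f                                 ≡⟨ ∑<-+-split m N f ⟩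
  ∑< m f + ∑[ k < N ] f (m + k)                ≡⟨ cong (∑< m f +_) (∑<-cong N (λ k _ → reassoc k)) ⟩
  ∑< m f + ∑[ k < N ] mono σ (k + (m + β)) (k + (m + γ)) s a c
                                               ≡⟨ cong (∑< m f +_) (geomQV-mono σ (m + β) (m + γ) s a c) ⟨
  ∑< m f + geomQV (mono σ (m + β) (m + γ)) s a c ∎
  where
  open ≡-Reasoning
  N = suc (a ⊓ c)
  f : ℕ → ℕ
  f k = mono σ (k + β) (k + γ) s a c
  reassoc : ∀ k → f (m + k) ≡ mono σ (k + (m + β)) (k + (m + γ)) s a c
  reassoc k = cong₂ (λ x y → mono σ x y s a c) (m+k+x≡k+[m+x] β) (m+k+x≡k+[m+x] γ)
    where
    m+k+x≡k+[m+x] : ∀ x → m + k + x ≡ k + (m + x)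
    m+k+x≡k+[m+x] x = trans (cong (_+ x) (+-comm m k)) (+-assoc k m x)

lastLetter : List ℕ → ℕ
lastLetter []           = 0
lastLetter (x ∷ [])     = x
lastLetter (_ ∷ y ∷ ys) = lastLetter (y ∷ ys)

endsWithWeakDescent : List ℕ → Bool
endsWithWeakDescent (x ∷ y ∷ [])     = y ≤ᵇ x
endsWithWeakDescent (_ ∷ y ∷ z ∷ zs) = endsWithWeakDescent (y ∷ z ∷ zs)
endsWithWeakDescent _                = false

avoider : List ℕ → Bool
avoider w = isCatalan w ∧ avoidsGeGe w

weight : List ℕ → Coeffs
weight w = mono (sper w) (area w) (lastLetter w)

lastLetter-∷ʳ : ∀ u x → lastLetter (u ∷ʳ x) ≡ x
lastLetter-∷ʳ []          x = refl
lastLetter-∷ʳ (_ ∷ [])    x = refl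
lastLetter-∷ʳ (_ ∷ y ∷ u) x = lastLetter-∷ʳ (y ∷ u) x

lastIs-lastLetter : ∀ i a r → lastIs i (a ∷ r) ≡ (lastLetter (a ∷ r) ≡ᵇ i)
lastIs-lastLetter i a []      = refl
lastIs-lastLetter i a (b ∷ r) = lastIs-lastLetter i b r

endsWithWeakDescent-∷ʳ : ∀ a r x → endsWithWeakDescent ((a ∷ r) ∷ʳ x) ≡ (x ≤ᵇ lastLetter (a ∷ r))
endsWithWeakDescent-∷ʳ a []          x = refl
endsWithWeakDescent-∷ʳ a (b ∷ [])    x = refl
endsWithWeakDescent-∷ʳ a (b ∷ c ∷ r) x = endsWithWeakDescent-∷ʳ b (c ∷ r) x

catStep-∷ʳ : ∀ p r x → catStep p (r ∷ʳ x) ≡ catStep p r ∧ (x ≤ᵇ suc (lastLetter (p ∷ r)))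
catStep-∷ʳ p []      x = ∧-identityʳ _
catStep-∷ʳ p (y ∷ r) x =
  trans (cong ((y ≤ᵇ suc p) ∧_) (catStep-∷ʳ y r x)) (sym (∧-assoc (y ≤ᵇ suc p) _ _))

isCatalan-∷ʳ : ∀ a r x → isCatalan ((a ∷ r) ∷ʳ x) ≡ isCatalan (a ∷ r) ∧ (x ≤ᵇ suc (lastLetter (a ∷ r)))
isCatalan-∷ʳ a r x = trans (cong ((a ≡ᵇ 0) ∧_) (catStep-∷ʳ a r x)) (sym (∧-assoc (a ≡ᵇ 0) _ _))

avoidsGeGe-∷ʳ : ∀ a r x → avoidsGeGe ((a ∷ r) ∷ʳ x) ≡
  avoidsGeGe (a ∷ r) ∧ not (endsWithWeakDescent (a ∷ r) ∧ (x ≤ᵇ lastLetter (a ∷ r)))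
avoidsGeGe-∷ʳ a []          x = refl
avoidsGeGe-∷ʳ a (b ∷ [])    x = ∧-identityʳ _
avoidsGeGe-∷ʳ a (b ∷ c ∷ r) x =
  trans (cong (not ((b ≤ᵇ a) ∧ (c ≤ᵇ b)) ∧_) (avoidsGeGe-∷ʳ b (c ∷ r) x))
        (sym (∧-assoc (not ((b ≤ᵇ a) ∧ (c ≤ᵇ b))) _ _))

avoider-∷ʳ : ∀ a r x → avoider ((a ∷ r) ∷ʳ x) ≡ avoider (a ∷ r) ∧
  ((x ≤ᵇ suc (lastLetter (a ∷ r))) ∧ not (endsWithWeakDescent (a ∷ r) ∧ (x ≤ᵇ lastLetter (a ∷ r))))
avoider-∷ʳ a r x = trans (cong₂ _∧_ (isCatalan-∷ʳ a r x) (avoidsGeGe-∷ʳ a r x))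
  (∧-interchange (isCatalan (a ∷ r)) _ (avoidsGeGe (a ∷ r)) _)

catStep-lastLetter : ∀ p r → T (catStep p r) → lastLetter (p ∷ r) ≤ p + length r
catStep-lastLetter p []      _ = m≤m+n p 0
catStep-lastLetter p (y ∷ r) t with T-∧ {y ≤ᵇ suc p} .Equivalence.to t
... | y≤1+p , t′ = begin
  lastLetter (y ∷ r)  ≤⟨ catStep-lastLetter y r t′ ⟩
  y + length r        ≤⟨ +-monoˡ-≤ (length r) (≤ᵇ⇒≤ y (suc p) y≤1+p) ⟩
  suc p + length r    ≡⟨ +-suc p (length r) ⟨
  p + length (y ∷ r)  ∎
  where open ≤-Reasoning

isCatalan-lastLetter : ∀ a r → T (isCatalan (a ∷ r)) → lastLetter (a ∷ r) ≤ length r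
isCatalan-lastLetter a r t with T-∧ {a ≡ᵇ 0} .Equivalence.to t
... | a≡0 , t′ with ≡ᵇ⇒≡ a 0 a≡0
... | refl = catStep-lastLetter 0 r t′

∑<-above : ∀ n l → ∑[ j < n ] ind (not (j ≤ᵇ l)) ≡ n ∸ suc l
∑<-above zero    l = refl
∑<-above (suc n) l with n ≤ᵇ l | ≤ᵇ-reflects-≤ n l
... | true  | ofʸ n≤l =
  trans (+-identityʳ _) (trans (∑<-above n l) (trans (m≤n⇒m∸n≡0 (m≤n⇒m≤1+n n≤l)) (sym (m≤n⇒m∸n≡0 n≤l))))
... | false | ofⁿ n≰l =
  trans (cong (_+ 1) (∑<-above n l)) (trans (sym (+-∸-comm 1 (≰⇒> n≰l))) (cong (_∸ suc l) (+-comm n 1)))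

exposedSide-just : ∀ w l → exposedSide w (just l) ≡ w ∸ l
exposedSide-just w l = begin
  length (filter (λ j → ¬? (j ≤? l)) (upTo (suc w)))  ≡⟨ length-filter (λ j → ¬? (j ≤? l)) (upTo (suc w)) ⟩
  ∑[ j ∈ upTo (suc w) ] ind (not (j ≤ᵇ l))            ≡⟨ ∑<-upTo (suc w) _ ⟩
  ∑[ j < suc w ] ind (not (j ≤ᵇ l))                   ≡⟨ ∑<-above (suc w) l ⟩
  w ∸ l                                               ∎
  where open ≡-Reasoning

area-∷ʳ : ∀ u x → area (u ∷ʳ x) ≡ area u + suc x
area-∷ʳ []      x = cong suc (+-identityʳ x)
area-∷ʳ (y ∷ u) x = trans (cong (suc y +_) (area-∷ʳ u x)) (sym (+-assoc (suc y) (area u) (suc x)))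

perimeterFrom-∷ʳ : ∀ p a r x → let L = lastLetter (a ∷ r) in
  perimeterFrom p ((a ∷ r) ∷ʳ x) + suc L ≡ perimeterFrom p (a ∷ r) + (2 + (L ∸ x) + (x ∸ L) + suc x)
perimeterFrom-∷ʳ p a [] x
  rewrite exposedSide-just a x | exposedSide-just x a =
  solve 5 (λ e u v a x → con 2 :+ e :+ u :+ (con 2 :+ v :+ (con 1 :+ x) :+ con 0) :+ (con 1 :+ a)
                      := con 2 :+ e :+ (con 1 :+ a) :+ con 0 :+ (con 2 :+ u :+ v :+ (con 1 :+ x)))
          refl (exposedSide a p) (a ∸ x) (x ∸ a) a x
perimeterFrom-∷ʳ p a (b ∷ r) x =
  trans (+-assoc K (perimeterFrom (just a) ((b ∷ r) ∷ʳ x)) _)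
        (trans (cong (K +_) (perimeterFrom-∷ʳ (just a) b r x)) (sym (+-assoc K _ _)))
  where K = 2 + exposedSide a p + exposedSide a (just b)

m∸n+n≡m+[n∸m] : ∀ m n → m ∸ n + n ≡ m + (n ∸ m)
m∸n+n≡m+[n∸m] m n with ≤-total m n
... | inj₁ m≤n = trans (cong (_+ n) (m≤n⇒m∸n≡0 m≤n)) (sym (m+[n∸m]≡n m≤n))
... | inj₂ n≤m = trans (m∸n+n≡m n≤m) (sym (trans (cong (m +_) (m≤n⇒m∸n≡0 n≤m)) (+-identityʳ m)))

perimeter-∷ʳ : ∀ a r x → perimeter ((a ∷ r) ∷ʳ x) ≡ perimeter (a ∷ r) + suc (x ∸ lastLetter (a ∷ r)) * 2
perimeter-∷ʳ a r x = +-cancelʳ-≡ (suc L) _ _ (begin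
  perimeter ((a ∷ r) ∷ʳ x) + suc L                ≡⟨ perimeterFrom-∷ʳ nothing a r x ⟩
  perimeter (a ∷ r) + (2 + (L ∸ x) + (x ∸ L) + suc x)
    ≡⟨ cong (perimeter (a ∷ r) +_)
            (solve 3 (λ u v x → con 2 :+ u :+ v :+ (con 1 :+ x) := con 2 :+ (u :+ x) :+ v :+ con 1) refl (L ∸ x) (x ∸ L) x) ⟩
  perimeter (a ∷ r) + (2 + (L ∸ x + x) + (x ∸ L) + 1)
    ≡⟨ cong (λ y → perimeter (a ∷ r) + (2 + y + (x ∸ L) + 1)) (m∸n+n≡m+[n∸m] L x) ⟩
  perimeter (a ∷ r) + (2 + (L + (x ∸ L)) + (x ∸ L) + 1)
    ≡⟨ solve 3 (λ P L v → P :+ (con 2 :+ (L :+ v) :+ v :+ con 1) := P :+ (con 1 :+ v) :* con 2 :+ (con 1 :+ L))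
               refl (perimeter (a ∷ r)) L (x ∸ L) ⟩
  perimeter (a ∷ r) + suc (x ∸ L) * 2 + suc L     ∎)
  where
  open ≡-Reasoning
  L = lastLetter (a ∷ r)

sper-∷ʳ : ∀ a r x → sper ((a ∷ r) ∷ʳ x) ≡ sper (a ∷ r) + suc (x ∸ lastLetter (a ∷ r))
sper-∷ʳ a r x = begin
  perimeter ((a ∷ r) ∷ʳ x) / 2          ≡⟨ cong (_/ 2) (perimeter-∷ʳ a r x) ⟩
  (perimeter (a ∷ r) + k * 2) / 2       ≡⟨ +-distrib-/-∣ʳ (perimeter (a ∷ r)) {d = 2} (divides-refl k) ⟩
  sper (a ∷ r) + k * 2 / 2              ≡⟨ cong (sper (a ∷ r) +_) (m*n/n≡m k 2) ⟩
  sper (a ∷ r) + k                      ∎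
  where
  open ≡-Reasoning
  k = suc (x ∸ lastLetter (a ∷ r))

weight-∷ʳ : ∀ a r x → weight ((a ∷ r) ∷ʳ x) ≡
  mono (sper (a ∷ r) + suc (x ∸ lastLetter (a ∷ r))) (area (a ∷ r) + suc x) x
weight-∷ʳ a r x = mono-cong (sper-∷ʳ a r x) (area-∷ʳ (a ∷ r) x) (lastLetter-∷ʳ (a ∷ r) x)

weight-ascent : ∀ a r → let u = a ∷ r; L = lastLetter u in
  weight (u ∷ʳ suc L) ≡ mono (2 + sper u) (2 + (1 * L + area u)) (1 + L)
weight-ascent a r = trans (weight-∷ʳ a r (suc L)) (mono-cong
  (trans (cong (λ k → sper u + suc k) (m+n∸n≡m 1 L)) (+-comm (sper u) 2))
  (solve 2 (λ L α → α :+ (con 2 :+ L) := con 2 :+ (con 1 :* L :+ α)) refl L (area u))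
  (refl {x = suc L}))
  where
  u = a ∷ r
  L = lastLetter u

weight-peak : ∀ a r x → let u = a ∷ r; L = lastLetter u in
  x < 2 + L → weight ((u ∷ʳ suc L) ∷ʳ x) ≡ mono (3 + sper u) (x + (3 + (L + area u))) (x + 0)
weight-peak a r x x<2+L = trans (weight-∷ʳ a (r ∷ʳ suc L) x) (mono-cong
  (begin
    sper (u ∷ʳ suc L) + suc (x ∸ lastLetter (u ∷ʳ suc L))
      ≡⟨ cong₂ (λ σ k → σ + suc (x ∸ k)) (sper-∷ʳ a r (suc L)) (lastLetter-∷ʳ u (suc L)) ⟩
    sper u + suc (suc L ∸ L) + suc (x ∸ suc L)
      ≡⟨ cong₂ (λ k l → sper u + suc k + suc l) (m+n∸n≡m 1 L) (m≤n⇒m∸n≡0 (s≤s⁻¹ x<2+L)) ⟩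
    sper u + 2 + 1
      ≡⟨ solve 1 (λ σ → σ :+ con 2 :+ con 1 := con 3 :+ σ) refl (sper u) ⟩
    3 + sper u
      ∎)
  (begin
    area (u ∷ʳ suc L) + suc x
      ≡⟨ cong (_+ suc x) (area-∷ʳ u (suc L)) ⟩
    area u + suc (suc L) + suc x
      ≡⟨ solve 3 (λ α L x → α :+ (con 2 :+ L) :+ (con 1 :+ x) := x :+ (con 3 :+ (L :+ α))) refl (area u) L x ⟩
    x + (3 + (L + area u))
      ∎)
  (sym (+-identityʳ x)))
  where
  open ≡-Reasoning
  u = a ∷ r
  L = lastLetter u

-- Letters below b: cutting off the last letter keeps b, so the recursion needs general b ≥ n.
∑avoidersBelow : ℕ → ℕ → (List ℕ → ℕ) → ℕ
∑avoidersBelow b n g = ∑[ w ∈ listsOf n b ] (ind (avoider w) * g w)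

∑avoiders : ℕ → (List ℕ → ℕ) → ℕ
∑avoiders n = ∑avoidersBelow n n

∑extensions : (List ℕ → ℕ) → List ℕ → ℕ
∑extensions g u = g (u ∷ʳ suc L) + ind (not (endsWithWeakDescent u)) * ∑[ x < suc L ] g (u ∷ʳ x)
  where L = lastLetter u

∑listsOf-∷ : ∀ n b (g : List ℕ → ℕ) → ∑∈ (listsOf (suc n) b) g ≡ ∑[ x < b ] ∑[ w ∈ listsOf n b ] g (x ∷ w)
∑listsOf-∷ n b g = begin
  ∑∈ (concatMap (λ x → map (x ∷_) (listsOf n b)) (upTo b)) g  ≡⟨ ∑∈-concatMap _ (upTo b) g ⟩
  ∑[ x ∈ upTo b ] ∑∈ (map (x ∷_) (listsOf n b)) g             ≡⟨ ∑∈-cong (upTo b) (λ x → ∑∈-map (x ∷_) (listsOf n b) g) ⟩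
  ∑[ x ∈ upTo b ] ∑[ w ∈ listsOf n b ] g (x ∷ w)              ≡⟨ ∑<-upTo b _ ⟩
  ∑[ x < b ] ∑[ w ∈ listsOf n b ] g (x ∷ w)                   ∎
  where open ≡-Reasoning

∑listsOf-∷ʳ : ∀ n b (g : List ℕ → ℕ) → ∑∈ (listsOf (suc n) b) g ≡ ∑[ u ∈ listsOf n b ] ∑[ x < b ] g (u ∷ʳ x)
∑listsOf-∷ʳ zero    b g =
  trans (∑listsOf-∷ 0 b g) (trans (∑<-cong b (λ x _ → +-identityʳ (g (x ∷ [])))) (sym (+-identityʳ _)))
∑listsOf-∷ʳ (suc n) b g = begin
  ∑∈ (listsOf (2 + n) b) g                                    ≡⟨ ∑listsOf-∷ (suc n) b g ⟩
  ∑[ y < b ] ∑[ w ∈ listsOf (suc n) b ] g (y ∷ w)             ≡⟨ ∑<-cong b (λ y _ → ∑listsOf-∷ʳ n b (λ w → g (y ∷ w))) ⟩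
  ∑[ y < b ] ∑[ u ∈ listsOf n b ] ∑[ x < b ] g (y ∷ u ∷ʳ x)   ≡⟨ ∑listsOf-∷ n b (λ u → ∑[ x < b ] g (u ∷ʳ x)) ⟨
  ∑[ u ∈ listsOf (suc n) b ] ∑[ x < b ] g (u ∷ʳ x)            ∎
  where open ≡-Reasoning

∑listsOf-cong : ∀ n b {f g : List ℕ → ℕ} → (∀ w → length w ≡ n → f w ≡ g w) →
                ∑∈ (listsOf n b) f ≡ ∑∈ (listsOf n b) g
∑listsOf-cong zero    b f≗g = cong (_+ 0) (f≗g [] refl)
∑listsOf-cong (suc n) b {f} {g} f≗g = begin
  ∑∈ (listsOf (suc n) b) f                   ≡⟨ ∑listsOf-∷ n b f ⟩
  ∑[ x < b ] ∑[ w ∈ listsOf n b ] f (x ∷ w)  ≡⟨ ∑<-cong b (λ x _ → ∑listsOf-cong n b (λ w |w| → f≗g (x ∷ w) (cong suc |w|))) ⟩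
  ∑[ x < b ] ∑[ w ∈ listsOf n b ] g (x ∷ w)  ≡⟨ ∑listsOf-∷ n b g ⟨
  ∑∈ (listsOf (suc n) b) g                   ∎
  where open ≡-Reasoning

∑<-extensions : ∀ {L b} E (G : ℕ → ℕ) → suc (suc L) ≤ b →
  ∑[ x < b ] (ind ((x ≤ᵇ suc L) ∧ not (E ∧ (x ≤ᵇ L))) * G x) ≡ G (suc L) + ind (not E) * ∑< (suc L) G
∑<-extensions {L} {b} E G 2+L≤b = begin
  ∑< b F                                       ≡⟨ ∑<-support F 2+L≤b beyond ⟩
  ∑< (suc L) F + F (suc L)                     ≡⟨ cong₂ _+_ (∑<-cong (suc L) below) top ⟩
  ∑[ x < suc L ] (ind (not E) * G x) + G (suc L) ≡⟨ +-comm _ (G (suc L)) ⟩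
  G (suc L) + ∑[ x < suc L ] (ind (not E) * G x) ≡⟨ cong (G (suc L) +_) (∑<-*ˡ (suc L) (ind (not E)) G) ⟩
  G (suc L) + ind (not E) * ∑< (suc L) G       ∎
  where
  open ≡-Reasoning
  F : ℕ → ℕ
  F x = ind ((x ≤ᵇ suc L) ∧ not (E ∧ (x ≤ᵇ L))) * G x
  beyond : ∀ x → suc (suc L) ≤ x → F x ≡ 0
  beyond x 2+L≤x rewrite ≤ᵇ-false 2+L≤x = refl
  top : F (suc L) ≡ G (suc L)
  top rewrite ≤ᵇ-true (≤-refl {suc L}) | ≤ᵇ-false (≤-refl {suc L}) | ∧-zeroʳ E = +-identityʳ (G (suc L))
  below : ∀ x → x < suc L → F x ≡ ind (not E) * G x
  below x x<1+L rewrite ≤ᵇ-true (m≤n⇒m≤1+n (s≤s⁻¹ x<1+L)) | ≤ᵇ-true (s≤s⁻¹ x<1+L) | ∧-identityʳ E = refl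

∑avoidersBelow-∷ʳ : ∀ {n b} (g : List ℕ → ℕ) → suc (suc n) ≤ b →
  ∑avoidersBelow b (suc (suc n)) g ≡ ∑avoidersBelow b (suc n) (∑extensions g)
∑avoidersBelow-∷ʳ {n} {b} g 2+n≤b = trans (∑listsOf-∷ʳ (suc n) b _) (∑listsOf-cong (suc n) b extend)
  where
  extend : ∀ u → length u ≡ suc n →
           ∑[ x < b ] (ind (avoider (u ∷ʳ x)) * g (u ∷ʳ x)) ≡ ind (avoider u) * ∑extensions g u
  extend (a ∷ r) refl = begin
    ∑[ x < b ] (ind (avoider (u ∷ʳ x)) * g (u ∷ʳ x))        ≡⟨ ∑<-cong b (λ x _ → split x) ⟩
    ∑[ x < b ] (ind (avoider u) * (ind (ext x) * g (u ∷ʳ x))) ≡⟨ ∑<-*ˡ b (ind (avoider u)) _ ⟩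
    ind (avoider u) * ∑[ x < b ] (ind (ext x) * g (u ∷ʳ x)) ≡⟨ ind-guard (avoider u) sum-ext ⟩
    ind (avoider u) * ∑extensions g u                        ∎
    where
    open ≡-Reasoning
    u = a ∷ r
    L = lastLetter u
    ext : ℕ → Bool
    ext x = (x ≤ᵇ suc L) ∧ not (endsWithWeakDescent u ∧ (x ≤ᵇ L))
    split : ∀ x → ind (avoider (u ∷ʳ x)) * g (u ∷ʳ x) ≡ ind (avoider u) * (ind (ext x) * g (u ∷ʳ x))
    split x = trans (cong (λ y → ind y * g (u ∷ʳ x)) (avoider-∷ʳ a r x))
                    (trans (cong (_* g (u ∷ʳ x)) (ind-∧ (avoider u) (ext x))) (*-assoc (ind (avoider u)) _ _))
    sum-ext : T (avoider u) → ∑[ x < b ] (ind (ext x) * g (u ∷ʳ x)) ≡ ∑extensions g u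
    sum-ext t with T-∧ {isCatalan u} .Equivalence.to t
    ... | cat , _ = ∑<-extensions (endsWithWeakDescent u) (λ x → g (u ∷ʳ x))
                      (≤-trans (s≤s (s≤s (isCatalan-lastLetter a r cat))) 2+n≤b)

∑avoidersBelow-1 : ∀ {b} (g : List ℕ → ℕ) → 1 ≤ b → ∑avoidersBelow b 1 g ≡ g (0 ∷ [])
∑avoidersBelow-1 {b} g 1≤b = begin
  ∑avoidersBelow b 1 g  ≡⟨ ∑listsOf-∷ 0 b _ ⟩
  ∑< b F                ≡⟨ ∑<-support F 1≤b beyond ⟩
  0 + F 0               ≡⟨ solve 1 (λ x → con 0 :+ (con 1 :* x :+ con 0) := x) refl (g (0 ∷ [])) ⟩
  g (0 ∷ [])            ∎
  where
  open ≡-Reasoning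
  F : ℕ → ℕ
  F x = ind (avoider (x ∷ [])) * g (x ∷ []) + 0
  beyond : ∀ x → 1 ≤ x → F x ≡ 0
  beyond (suc x) _ = refl

∑avoidersBelow-bound : ∀ n {b} (g : List ℕ → ℕ) → n ≤ b → ∑avoidersBelow b n g ≡ ∑avoiders n g
∑avoidersBelow-bound zero          g _   = refl
∑avoidersBelow-bound (suc zero)    g 1≤b = trans (∑avoidersBelow-1 g 1≤b) (sym (∑avoidersBelow-1 g ≤-refl))
∑avoidersBelow-bound (suc (suc n)) {b} g n≤b = begin
  ∑avoidersBelow b (2 + n) g                          ≡⟨ ∑avoidersBelow-∷ʳ {n} g n≤b ⟩
  ∑avoidersBelow b (1 + n) (∑extensions g)            ≡⟨ ∑avoidersBelow-bound (suc n) _ (≤-trans (n≤1+n _) n≤b) ⟩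
  ∑avoiders (1 + n) (∑extensions g)                   ≡⟨ ∑avoidersBelow-bound (suc n) _ (n≤1+n _) ⟨
  ∑avoidersBelow (2 + n) (1 + n) (∑extensions g)      ≡⟨ ∑avoidersBelow-∷ʳ {n} g ≤-refl ⟨
  ∑avoiders (2 + n) g                                 ∎
  where open ≡-Reasoning

∑avoiders-∷ʳ : ∀ n (g : List ℕ → ℕ) → ∑avoiders (suc (suc n)) g ≡ ∑avoiders (suc n) (∑extensions g)
∑avoiders-∷ʳ n g = trans (∑avoidersBelow-∷ʳ {n} g ≤-refl) (∑avoidersBelow-bound (suc n) _ (n≤1+n _))

∑avoiders-cong : ∀ n {f g : List ℕ → ℕ} → (∀ w → f w ≡ g w) → ∑avoiders n f ≡ ∑avoiders n g
∑avoiders-cong n f≗g = ∑∈-cong (listsOf n n) (λ w → cong (ind (avoider w) *_) (f≗g w))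

∑avoiders-cong⁺ : ∀ n {f g : List ℕ → ℕ} → (∀ a r → f (a ∷ r) ≡ g (a ∷ r)) →
                  ∑avoiders (suc n) f ≡ ∑avoiders (suc n) g
∑avoiders-cong⁺ n {f} {g} f≗g = ∑listsOf-cong (suc n) (suc n) nonempty
  where
  nonempty : ∀ w → length w ≡ suc n → ind (avoider w) * f w ≡ ind (avoider w) * g w
  nonempty (a ∷ r) _ = cong (ind (avoider (a ∷ r)) *_) (f≗g a r)

∑avoiders-+ : ∀ n (f g : List ℕ → ℕ) → ∑avoiders n (λ w → f w + g w) ≡ ∑avoiders n f + ∑avoiders n g
∑avoiders-+ n f g = trans (∑∈-cong (listsOf n n) (λ w → *-distribˡ-+ (ind (avoider w)) (f w) (g w)))
                          (∑∈-+ (listsOf n n) (λ w → ind (avoider w) * f w) (λ w → ind (avoider w) * g w))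

∑avoiders-*ˡ : ∀ n k (f : List ℕ → ℕ) → ∑avoiders n (λ w → k * f w) ≡ k * ∑avoiders n f
∑avoiders-*ˡ n k f = trans (∑∈-cong (listsOf n n) (λ w → x*[y*z]≡y*[x*z] (ind (avoider w)) k (f w)))
                           (∑∈-*ˡ (listsOf n n) k _)

∑<-∑avoiders-comm : ∀ m n (F : ℕ → List ℕ → ℕ) →
                    ∑[ i < m ] ∑avoiders n (F i) ≡ ∑avoiders n (λ w → ∑[ i < m ] F i w)
∑<-∑avoiders-comm m n F = trans (∑<-∑∈-comm m (listsOf n n) (λ i w → ind (avoider w) * F i w))
                                (∑∈-cong (listsOf n n) (λ w → ∑<-*ˡ m (ind (avoider w)) (λ i → F i w)))

∑avoiders-ascents : ∀ n (h : List ℕ → ℕ) →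
  ∑avoiders (2 + n) (λ u → ind (not (endsWithWeakDescent u)) * h u) ≡
  ∑avoiders (1 + n) (λ u → h (u ∷ʳ suc (lastLetter u)))
∑avoiders-ascents n h = trans (∑avoiders-∷ʳ n _) (∑avoiders-cong⁺ n pointwise)
  where
  pointwise : ∀ a r → ∑extensions (λ u → ind (not (endsWithWeakDescent u)) * h u) (a ∷ r) ≡
                      h ((a ∷ r) ∷ʳ suc (lastLetter (a ∷ r)))
  pointwise a r = begin
    ind (not (endsWithWeakDescent (u ∷ʳ suc L))) * h (u ∷ʳ suc L) + ind (not (endsWithWeakDescent u)) *
      ∑[ x < suc L ] (ind (not (endsWithWeakDescent (u ∷ʳ x))) * h (u ∷ʳ x))
      ≡⟨ cong₂ (λ y z → ind (not y) * h (u ∷ʳ suc L) + ind (not (endsWithWeakDescent u)) * z)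
               (trans (endsWithWeakDescent-∷ʳ a r (suc L)) (≤ᵇ-false (≤-refl {suc L})))
               (∑<-zero (suc L) _ descents) ⟩
    1 * h (u ∷ʳ suc L) + ind (not (endsWithWeakDescent u)) * 0
      ≡⟨ cong₂ _+_ (*-identityˡ _) (*-zeroʳ (ind (not (endsWithWeakDescent u)))) ⟩
    h (u ∷ʳ suc L) + 0
      ≡⟨ +-identityʳ _ ⟩
    h (u ∷ʳ suc L) ∎
    where
    open ≡-Reasoning
    u = a ∷ r
    L = lastLetter u
    descents : ∀ x → x < suc L → ind (not (endsWithWeakDescent (u ∷ʳ x))) * h (u ∷ʳ x) ≡ 0
    descents x x<1+L rewrite endsWithWeakDescent-∷ʳ a r x | ≤ᵇ-true (s≤s⁻¹ x<1+L) = refl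

∑avoiders-split : ∀ n (g : List ℕ → ℕ) →
  ∑avoiders (3 + n) g ≡
  ∑avoiders (2 + n) (λ u → g (u ∷ʳ suc (lastLetter u))) +
  ∑avoiders (1 + n) (λ u → ∑[ x < 2 + lastLetter u ] g ((u ∷ʳ suc (lastLetter u)) ∷ʳ x))
∑avoiders-split n g = let ascents = ∑avoiders (2 + n) (λ u → g (u ∷ʳ suc (lastLetter u))) in begin
  ∑avoiders (3 + n) g
    ≡⟨ ∑avoiders-∷ʳ (suc n) g ⟩
  ∑avoiders (2 + n) (∑extensions g)
    ≡⟨ ∑avoiders-+ (2 + n) (λ u → g (u ∷ʳ suc (lastLetter u))) _ ⟩
  ∑avoiders (2 + n) (λ u → g (u ∷ʳ suc (lastLetter u))) +
  ∑avoiders (2 + n) (λ u → ind (not (endsWithWeakDescent u)) * ∑[ x < suc (lastLetter u) ] g (u ∷ʳ x))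
    ≡⟨ cong (ascents +_) (∑avoiders-ascents n (λ u → ∑[ x < suc (lastLetter u) ] g (u ∷ʳ x))) ⟩
  ∑avoiders (2 + n) (λ u → g (u ∷ʳ suc (lastLetter u))) +
  ∑avoiders (1 + n) (λ u → ∑[ x < suc (lastLetter (u ∷ʳ suc (lastLetter u))) ] g (u ∷ʳ suc (lastLetter u) ∷ʳ x))
    ≡⟨ cong (ascents +_) (∑avoiders-cong⁺ n (λ a r → let u = a ∷ r; u′ = u ∷ʳ suc (lastLetter u) in
         cong (λ m → ∑[ x < suc m ] g (u′ ∷ʳ x)) (lastLetter-∷ʳ u (suc (lastLetter u))))) ⟩
  ∑avoiders (2 + n) (λ u → g (u ∷ʳ suc (lastLetter u))) +
  ∑avoiders (1 + n) (λ u → ∑[ x < 2 + lastLetter u ] g ((u ∷ʳ suc (lastLetter u)) ∷ʳ x))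
    ∎
  where open ≡-Reasoning

if-pos : ∀ b m → (if b then ℤ.+ m else ℤ.+ 0) ≡ ℤ.+ (ind b * m)
if-pos true  m = cong ℤ.+_ (sym (+-identityʳ m))
if-pos false m = refl

sumℤ-pos : ∀ {f : A → ℤ} {F : A → ℕ} xs → (∀ x → f x ≡ ℤ.+ F x) → sumℤ (map f xs) ≡ ℤ.+ ∑∈ xs F
sumℤ-pos []       f≗F = refl
sumℤ-pos {F = F} (x ∷ xs) f≗F =
  trans (cong₂ ℤ._+_ (f≗F x) (sumℤ-pos xs f≗F)) (sym (pos-+ (F x) (∑∈ xs F)))

Ci-coeff : ∀ c n s a → Ci c (suc n) s a ≡ ℤ.+ ∑avoiders (suc n) (λ w → weight w s a c)
Ci-coeff c n s a = cong ℤ.+_ (begin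
  length (filter Pstat (filter Pword ws))                            ≡⟨ length-filter Pstat (filter Pword ws) ⟩
  ∑[ w ∈ filter Pword ws ] ind (does (Pstat w))                      ≡⟨ ∑∈-filter Pword ws _ ⟩
  ∑[ w ∈ ws ] (ind (does (Pword w)) * ind (does (Pstat w)))          ≡⟨ ∑listsOf-cong m m pointwise ⟩
  ∑avoiders m (λ w → weight w s a c)                                 ∎)
  where
  open ≡-Reasoning
  m = suc n
  ws = listsOf m m
  Pword : (w : List ℕ) → Dec ((isCatalan w ∧ avoidsGeGe w ∧ lastIs c w) ≡ true)
  Pstat : (w : List ℕ) → Dec (((sper w ≡ᵇ s) ∧ (area w ≡ᵇ a)) ≡ true)
  Pword w = (isCatalan w ∧ avoidsGeGe w ∧ lastIs c w) ≟B true
  Pstat w = ((sper w ≡ᵇ s) ∧ (area w ≡ᵇ a)) ≟B true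
  pointwise : ∀ w → length w ≡ m → ind (does (Pword w)) * ind (does (Pstat w)) ≡ ind (avoider w) * weight w s a c
  pointwise (x ∷ r) _ = begin
    ind (does (Pword w)) * ind (does (Pstat w))
      ≡⟨ cong₂ (λ y z → ind y * ind z) (does-≟true (isCatalan w ∧ avoidsGeGe w ∧ lastIs c w))
                                         (does-≟true ((sper w ≡ᵇ s) ∧ (area w ≡ᵇ a))) ⟩
    ind (isCatalan w ∧ avoidsGeGe w ∧ lastIs c w) * ind ((sper w ≡ᵇ s) ∧ (area w ≡ᵇ a))
      ≡⟨ cong₂ (λ y z → ind y * z) (trans (sym (∧-assoc (isCatalan w) _ _)) (cong (avoider w ∧_) (lastIs-lastLetter c x r)))
                                   (ind-∧ (sper w ≡ᵇ s) (area w ≡ᵇ a)) ⟩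
    ind (avoider w ∧ (lastLetter w ≡ᵇ c)) * (δ (sper w) s * δ (area w) a)
      ≡⟨ cong (_* (δ (sper w) s * δ (area w) a)) (ind-∧ (avoider w) (lastLetter w ≡ᵇ c)) ⟩
    ind (avoider w) * δ (lastLetter w) c * (δ (sper w) s * δ (area w) a)
      ≡⟨ solve 4 (λ i l σ α → i :* l :* (σ :* α) := i :* (σ :* α :* l))
                 refl (ind (avoider w)) (δ (lastLetter w) c) (δ (sper w) s) (δ (area w) a) ⟩
    ind (avoider w) * weight w s a c
      ∎
    where w = x ∷ r

mon-coeff : ∀ dx dp dq dv (f : FPS) {F : Coeffs} n → (∀ s a c → f n s a c ≡ ℤ.+ F s a c) →
            ∀ s a c → mon dx dp dq dv f (dx + n) s a c ≡ ℤ.+ shiftBy dp dq dv F s a c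
mon-coeff dx dp dq dv f {F} n f≗F s a c = begin
  (if (dx ≤ᵇ dx + n) ∧ cond then f (dx + n ∸ dx) (s ∸ dp) (a ∸ dq) (c ∸ dv) else ℤ.+ 0)
    ≡⟨ cong₂ (λ x m → if x ∧ cond then f m (s ∸ dp) (a ∸ dq) (c ∸ dv) else ℤ.+ 0)
             (≤ᵇ-true (m≤m+n dx n)) (m+n∸m≡n dx n) ⟩
  (if cond then f n (s ∸ dp) (a ∸ dq) (c ∸ dv) else ℤ.+ 0)
    ≡⟨ cong (λ z → if cond then z else ℤ.+ 0) (f≗F (s ∸ dp) (a ∸ dq) (c ∸ dv)) ⟩
  (if cond then ℤ.+ F (s ∸ dp) (a ∸ dq) (c ∸ dv) else ℤ.+ 0)
    ≡⟨ if-pos cond _ ⟩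
  ℤ.+ shiftBy dp dq dv F s a c
    ∎
  where
  open ≡-Reasoning
  cond = (dp ≤ᵇ s) ∧ (dq ≤ᵇ a) ∧ (dv ≤ᵇ c)

mon-zero : ∀ dx dp dq dv (f : FPS) n → (∀ s a c → f n s a c ≡ ℤ.+ 0) →
           ∀ s a c → mon dx dp dq dv f (dx + n) s a c ≡ ℤ.+ 0
mon-zero dx dp dq dv f n f≗0 s a c =
  trans (mon-coeff dx dp dq dv f {λ _ _ _ → 0} n f≗0 s a c)
        (cong ℤ.+_ (*-zeroʳ (ind ((dp ≤ᵇ s) ∧ (dq ≤ᵇ a) ∧ (dv ≤ᵇ c)))))

divOneMinusQV-coeff : ∀ (f : FPS) {F : Coeffs} n → (∀ s a c → f n s a c ≡ ℤ.+ F s a c) →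
                      ∀ s a c → divOneMinusQV f n s a c ≡ ℤ.+ geomQV F s a c
divOneMinusQV-coeff f {F} n f≗F s a c =
  trans (sumℤ-pos (upTo (suc (a ⊓ c))) (λ k → f≗F s (a ∸ k) (c ∸ k)))
        (cong ℤ.+_ (∑<-upTo (suc (a ⊓ c)) (λ k → F s (a ∸ k) (c ∸ k))))

divOneMinusQV-zero : ∀ (f : FPS) n → (∀ s a c → f n s a c ≡ ℤ.+ 0) →
                     ∀ s a c → divOneMinusQV f n s a c ≡ ℤ.+ 0
divOneMinusQV-zero f n f≗0 s a c =
  trans (divOneMinusQV-coeff f {λ _ _ _ → 0} n f≗0 s a c)
        (cong ℤ.+_ (∑<-zero (suc (a ⊓ c)) (λ _ → 0) (λ _ _ → refl)))

oneS-coeff : ∀ s a c → oneS 0 s a c ≡ ℤ.+ mono 0 0 0 s a c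
oneS-coeff s a c = begin
  (if (s ≡ᵇ 0) ∧ (a ≡ᵇ 0) ∧ (c ≡ᵇ 0) then ℤ.+ 1 else ℤ.+ 0)  ≡⟨ if-pos _ 1 ⟩
  ℤ.+ (ind ((s ≡ᵇ 0) ∧ (a ≡ᵇ 0) ∧ (c ≡ᵇ 0)) * 1)            ≡⟨ cong ℤ.+_ (trans (*-identityʳ _) indicator) ⟩
  ℤ.+ mono 0 0 0 s a c                                       ∎
  where
  open ≡-Reasoning
  indicator : ind ((s ≡ᵇ 0) ∧ (a ≡ᵇ 0) ∧ (c ≡ᵇ 0)) ≡ δ 0 s * δ 0 a * δ 0 c
  indicator = begin
    ind ((s ≡ᵇ 0) ∧ (a ≡ᵇ 0) ∧ (c ≡ᵇ 0))  ≡⟨ trans (ind-∧ (s ≡ᵇ 0) _) (cong (δ s 0 *_) (ind-∧ (a ≡ᵇ 0) (c ≡ᵇ 0))) ⟩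
    δ s 0 * (δ a 0 * δ c 0)               ≡⟨ sym (*-assoc (δ s 0) _ _) ⟩
    δ s 0 * δ a 0 * δ c 0                 ≡⟨ cong₂ _*_ (cong₂ _*_ (δ-sym s 0) (δ-sym a 0)) (δ-sym c 0) ⟩
    δ 0 s * δ 0 a * δ 0 c                 ∎

monomial-coeff : ∀ dx dp dq dv s a c → monomial dx dp dq dv (dx + 0) s a c ≡ ℤ.+ mono dp dq dv s a c
monomial-coeff dx dp dq dv s a c = begin
  mon dx dp dq dv oneS (dx + 0) s a c            ≡⟨ mon-coeff dx dp dq dv oneS 0 oneS-coeff s a c ⟩
  ℤ.+ shiftBy dp dq dv (mono 0 0 0) s a c         ≡⟨ cong ℤ.+_ (shiftBy-mono dp dq dv 0 0 0 s a c) ⟩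
  ℤ.+ mono (dp + 0) (dq + 0) (dv + 0) s a c       ≡⟨ cong (λ (F : Coeffs) → ℤ.+ F s a c)
                                                         (mono-cong (+-identityʳ dp) (+-identityʳ dq) (+-identityʳ dv)) ⟩
  ℤ.+ mono dp dq dv s a c                         ∎
  where open ≡-Reasoning

monomial-zero : ∀ dx dp dq dv n s a c → monomial dx dp dq dv (dx + suc n) s a c ≡ ℤ.+ 0
monomial-zero dx dp dq dv n = mon-zero dx dp dq dv oneS (suc n) (λ _ _ _ → refl)

CgfAtQjV-coeff : ∀ j n s a c →
  CgfAtQjV j (suc n) s a c ≡
  ℤ.+ ∑avoiders (suc n) (λ w → mono (sper w) (j * lastLetter w + area w) (lastLetter w) s a c)
CgfAtQjV-coeff j n s a c = begin
  (if j * c ≤ᵇ a then Ci c (suc n) s (a ∸ j * c) else ℤ.+ 0)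
    ≡⟨ cong (λ z → if j * c ≤ᵇ a then z else ℤ.+ 0) (Ci-coeff c n s (a ∸ j * c)) ⟩
  (if j * c ≤ᵇ a then ℤ.+ ∑avoiders (suc n) (λ w → weight w s (a ∸ j * c) c) else ℤ.+ 0)
    ≡⟨ if-pos (j * c ≤ᵇ a) _ ⟩
  ℤ.+ (ind (j * c ≤ᵇ a) * ∑avoiders (suc n) (λ w → weight w s (a ∸ j * c) c))
    ≡⟨ cong ℤ.+_ (∑avoiders-*ˡ (suc n) (ind (j * c ≤ᵇ a)) _) ⟨
  ℤ.+ ∑avoiders (suc n) (λ w → ind (j * c ≤ᵇ a) * weight w s (a ∸ j * c) c)
    ≡⟨ cong ℤ.+_ (∑avoiders-cong (suc n) (λ w → pointwise (sper w) (area w) (lastLetter w))) ⟩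
  ℤ.+ ∑avoiders (suc n) (λ w → mono (sper w) (j * lastLetter w + area w) (lastLetter w) s a c)
    ∎
  where
  open ≡-Reasoning
  pointwise : ∀ σ α L → ind (j * c ≤ᵇ a) * mono σ α L s (a ∸ j * c) c ≡ mono σ (j * L + α) L s a c
  pointwise σ α L = begin
    ind (j * c ≤ᵇ a) * (δ σ s * δ α (a ∸ j * c) * δ L c)
      ≡⟨ solve 4 (λ i x y z → i :* (x :* y :* z) := x :* (i :* y) :* z)
                 refl (ind (j * c ≤ᵇ a)) (δ σ s) (δ α (a ∸ j * c)) (δ L c) ⟩
    δ σ s * (ind (j * c ≤ᵇ a) * δ α (a ∸ j * c)) * δ L c
      ≡⟨ cong (λ x → δ σ s * x * δ L c) (δ-shift (j * c) α a) ⟩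
    δ σ s * δ (j * c + α) a * δ L c
      ≡⟨ *-comm _ (δ L c) ⟩
    δ L c * (δ σ s * δ (j * c + α) a)
      ≡⟨ δ-subst L c (λ x → δ σ s * δ (j * x + α) a) ⟩
    δ L c * (δ σ s * δ (j * L + α) a)
      ≡⟨ *-comm (δ L c) _ ⟩
    δ σ s * δ (j * L + α) a * δ L c
      ∎

CgfAtQ-coeff : ∀ n s a c →
  CgfAtQ (suc n) s a c ≡ ℤ.+ ∑avoiders (suc n) (λ w → mono (sper w) (lastLetter w + area w) 0 s a c)
CgfAtQ-coeff n s a c = begin
  (if c ≡ᵇ 0 then sumℤ (map (λ i → Ci i m s (a ∸ i)) (upTo (suc a))) else ℤ.+ 0)
    ≡⟨ cong (λ z → if c ≡ᵇ 0 then z else ℤ.+ 0) (sumℤ-pos (upTo (suc a)) (λ i → Ci-coeff i n s (a ∸ i))) ⟩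
  (if c ≡ᵇ 0 then ℤ.+ ∑[ i ∈ upTo (suc a) ] ∑avoiders m (λ w → weight w s (a ∸ i) i) else ℤ.+ 0)
    ≡⟨ if-pos (c ≡ᵇ 0) _ ⟩
  ℤ.+ (δ c 0 * ∑[ i ∈ upTo (suc a) ] ∑avoiders m (λ w → weight w s (a ∸ i) i))
    ≡⟨ cong (λ x → ℤ.+ (δ c 0 * x))
            (trans (∑<-upTo (suc a) _) (∑<-∑avoiders-comm (suc a) m (λ i w → weight w s (a ∸ i) i))) ⟩
  ℤ.+ (δ c 0 * ∑avoiders m (λ w → ∑[ i < suc a ] weight w s (a ∸ i) i))
    ≡⟨ cong ℤ.+_ (∑avoiders-*ˡ m (δ c 0) _) ⟨
  ℤ.+ ∑avoiders m (λ w → δ c 0 * ∑[ i < suc a ] weight w s (a ∸ i) i)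
    ≡⟨ cong ℤ.+_ (∑avoiders-cong m (λ w → pointwise (sper w) (area w) (lastLetter w))) ⟩
  ℤ.+ ∑avoiders m (λ w → mono (sper w) (lastLetter w + area w) 0 s a c)
    ∎
  where
  open ≡-Reasoning
  m = suc n
  pointwise : ∀ σ α L → δ c 0 * ∑[ i < suc a ] mono σ α L s (a ∸ i) i ≡ mono σ (L + α) 0 s a c
  pointwise σ α L = begin
    δ c 0 * ∑[ i < suc a ] (δ σ s * δ α (a ∸ i) * δ L i)  ≡⟨ cong (δ c 0 *_) (∑<-antidiagonal σ α L s a) ⟩
    δ c 0 * (δ σ s * δ (L + α) a)                         ≡⟨ *-comm (δ c 0) _ ⟩
    δ σ s * δ (L + α) a * δ c 0                           ≡⟨ cong (δ σ s * δ (L + α) a *_) (δ-sym c 0) ⟩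
    δ σ s * δ (L + α) a * δ 0 c                           ∎

CgfAtQ-empty : ∀ s a c → CgfAtQ 0 s a c ≡ ℤ.+ 0
CgfAtQ-empty s a c = begin
  (if c ≡ᵇ 0 then sumℤ (map (λ i → Ci i 0 s (a ∸ i)) (upTo (suc a))) else ℤ.+ 0)
    ≡⟨ cong (λ z → if c ≡ᵇ 0 then z else ℤ.+ 0) (sumℤ-pos {F = λ _ → 0} (upTo (suc a)) (λ _ → refl)) ⟩
  (if c ≡ᵇ 0 then ℤ.+ ∑[ i ∈ upTo (suc a) ] 0 else ℤ.+ 0)
    ≡⟨ cong (λ z → if c ≡ᵇ 0 then ℤ.+ z else ℤ.+ 0) (trans (∑<-upTo (suc a) _) (∑<-zero (suc a) _ (λ _ _ → refl))) ⟩
  (if c ≡ᵇ 0 then ℤ.+ 0 else ℤ.+ 0)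
    ≡⟨ if-pos (c ≡ᵇ 0) 0 ⟩
  ℤ.+ (δ c 0 * 0)
    ≡⟨ cong ℤ.+_ (*-zeroʳ (δ c 0)) ⟩
  ℤ.+ 0
    ∎
  where open ≡-Reasoning

CgfAtQjV-empty : ∀ j s a c → CgfAtQjV j 0 s a c ≡ ℤ.+ 0
CgfAtQjV-empty j s a c = trans (if-pos (j * c ≤ᵇ a) 0) (cong ℤ.+_ (*-zeroʳ (ind (j * c ≤ᵇ a))))

shiftBy-∑avoiders : ∀ dp dq dv m (σ α γ : List ℕ → ℕ) s a c →
  shiftBy dp dq dv (λ s a c → ∑avoiders m (λ w → mono (σ w) (α w) (γ w) s a c)) s a c ≡
  ∑avoiders m (λ w → mono (dp + σ w) (dq + α w) (dv + γ w) s a c)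
shiftBy-∑avoiders dp dq dv m σ α γ s a c =
  trans (sym (∑avoiders-*ˡ m (ind ((dp ≤ᵇ s) ∧ (dq ≤ᵇ a) ∧ (dv ≤ᵇ c)))
                               (λ w → mono (σ w) (α w) (γ w) (s ∸ dp) (a ∸ dq) (c ∸ dv))))
        (∑avoiders-cong m (λ w → shiftBy-mono dp dq dv (σ w) (α w) (γ w) s a c))

mon-CgfAtQjV-coeff : ∀ dx dp dq dv j n s a c → mon dx dp dq dv (CgfAtQjV j) (dx + suc n) s a c ≡
  ℤ.+ ∑avoiders (suc n) (λ u → mono (dp + sper u) (dq + (j * lastLetter u + area u)) (dv + lastLetter u) s a c)
mon-CgfAtQjV-coeff dx dp dq dv j n s a c =
  trans (mon-coeff dx dp dq dv (CgfAtQjV j) (suc n) (CgfAtQjV-coeff j n) s a c)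
        (cong ℤ.+_ (shiftBy-∑avoiders dp dq dv (suc n) sper (λ u → j * lastLetter u + area u) lastLetter s a c))

mon-CgfAtQ-coeff : ∀ dx dp dq dv n s a c → mon dx dp dq dv CgfAtQ (dx + suc n) s a c ≡
  ℤ.+ ∑avoiders (suc n) (λ u → mono (dp + sper u) (dq + (lastLetter u + area u)) (dv + 0) s a c)
mon-CgfAtQ-coeff dx dp dq dv n s a c =
  trans (mon-coeff dx dp dq dv CgfAtQ (suc n) (CgfAtQ-coeff n) s a c)
        (cong ℤ.+_ (shiftBy-∑avoiders dp dq dv (suc n) sper (λ u → lastLetter u + area u) (λ _ → 0) s a c))

divOneMinusQV-∑avoiders : ∀ (f : FPS) n m (F : List ℕ → Coeffs) →
  (∀ s a c → f n s a c ≡ ℤ.+ ∑avoiders m (λ w → F w s a c)) →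
  ∀ s a c → divOneMinusQV f n s a c ≡ ℤ.+ ∑avoiders m (λ w → geomQV (F w) s a c)
divOneMinusQV-∑avoiders f n m F f≗F s a c =
  trans (divOneMinusQV-coeff f n f≗F s a c)
        (cong ℤ.+_ (∑<-∑avoiders-comm (suc (a ⊓ c)) m (λ k w → F w s (a ∸ k) (c ∸ k))))

geomQV-peaks : ∀ σ α L s a c →
  geomQV (mono (3 + σ) (3 + (L + α)) 0) s a c ≡
  ∑[ x < 2 + L ] mono (3 + σ) (x + (3 + (L + α))) (x + 0) s a c +
  geomQV (mono (3 + σ) (5 + (2 * L + α)) (2 + L)) s a c
geomQV-peaks σ α L s a c =
  trans (geomQV-mono-split (2 + L) (3 + σ) (3 + (L + α)) 0 s a c)
        (cong (λ F → ∑[ x < 2 + L ] mono (3 + σ) (x + (3 + (L + α))) (x + 0) s a c + geomQV F s a c)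
              (mono-cong (refl {x = 3 + σ}) exponent (+-identityʳ (2 + L))))
  where
  exponent : 2 + L + (3 + (L + α)) ≡ 5 + (2 * L + α)
  exponent = solve 2 (λ L α → con 2 :+ L :+ (con 3 :+ (L :+ α)) := con 5 :+ (con 2 :* L :+ α)) refl L α

sum-minus-pos : ∀ {t₁ t₂ t₃ t₄ t₅ : ℤ} {x₁ x₂ x₃ x₄ y : ℕ} →
  t₁ ≡ ℤ.+ x₁ → t₂ ≡ ℤ.+ x₂ → t₃ ≡ ℤ.+ (x₃ + y) → t₄ ≡ ℤ.+ x₄ → t₅ ≡ ℤ.+ y →
  t₁ ℤ.+ t₂ ℤ.+ t₃ ℤ.+ t₄ ℤ.- t₅ ≡ ℤ.+ (x₁ + x₂ + x₃ + x₄)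
sum-minus-pos {x₁ = x₁} {x₂} {x₃} {x₄} {y} refl refl refl refl refl = begin
  ℤ.+ x₁ ℤ.+ ℤ.+ x₂ ℤ.+ ℤ.+ (x₃ + y) ℤ.+ ℤ.+ x₄ ℤ.- ℤ.+ y
    ≡⟨ cong (λ z → ℤ.+ x₁ ℤ.+ ℤ.+ x₂ ℤ.+ z ℤ.+ ℤ.+ x₄ ℤ.- ℤ.+ y) (pos-+ x₃ y) ⟩
  ℤ.+ x₁ ℤ.+ ℤ.+ x₂ ℤ.+ (ℤ.+ x₃ ℤ.+ ℤ.+ y) ℤ.+ ℤ.+ x₄ ℤ.- ℤ.+ y
    ≡⟨ ℤ-Solver.solve 5 (λ a b c d e → a ℤ-Solver.:+ b ℤ-Solver.:+ (c ℤ-Solver.:+ e) ℤ-Solver.:+ d ℤ-Solver.:- e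
                                       ℤ-Solver.:= a ℤ-Solver.:+ b ℤ-Solver.:+ c ℤ-Solver.:+ d)
                        refl (ℤ.+ x₁) (ℤ.+ x₂) (ℤ.+ x₃) (ℤ.+ x₄) (ℤ.+ y) ⟩
  ℤ.+ x₁ ℤ.+ ℤ.+ x₂ ℤ.+ ℤ.+ x₃ ℤ.+ ℤ.+ x₄
    ≡⟨ trans (cong (λ z → z ℤ.+ ℤ.+ x₃ ℤ.+ ℤ.+ x₄) (pos-+ x₁ x₂))
             (trans (cong (ℤ._+ ℤ.+ x₄) (pos-+ (x₁ + x₂) x₃)) (pos-+ (x₁ + x₂ + x₃) x₄)) ⟨
  ℤ.+ (x₁ + x₂ + x₃ + x₄)
    ∎
  where open ≡-Reasoning

T₃ T₄ T₅ : FPS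
T₃ = divOneMinusQV (mon 2 3 3 0 CgfAtQ)
T₄ = mon 1 2 2 1 (CgfAtQjV 1)
T₅ = divOneMinusQV (mon 2 3 5 2 (CgfAtQjV 2))

ascentTerm peakTerm correctionTerm : ℕ → Coeffs
ascentTerm n s a c =
  ∑avoiders n (λ u → mono (2 + sper u) (2 + (1 * lastLetter u + area u)) (1 + lastLetter u) s a c)
peakTerm n s a c =
  ∑avoiders n (λ u → ∑[ x < 2 + lastLetter u ] mono (3 + sper u) (x + (3 + (lastLetter u + area u))) (x + 0) s a c)
correctionTerm n s a c =
  ∑avoiders n (λ u → geomQV (mono (3 + sper u) (5 + (2 * lastLetter u + area u)) (2 + lastLetter u)) s a c)

T₃-short : ∀ n → n < 3 → ∀ s a c → T₃ n s a c ≡ ℤ.+ 0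
T₃-short 0 _ = divOneMinusQV-zero (mon 2 3 3 0 CgfAtQ) 0 (λ _ _ _ → refl)
T₃-short 1 _ = divOneMinusQV-zero (mon 2 3 3 0 CgfAtQ) 1 (λ _ _ _ → refl)
T₃-short 2 _ = divOneMinusQV-zero (mon 2 3 3 0 CgfAtQ) 2 (mon-zero 2 3 3 0 CgfAtQ 0 CgfAtQ-empty)
T₃-short (suc (suc (suc _))) (s≤s (s≤s (s≤s ())))

T₄-short : ∀ s a c → T₄ 1 s a c ≡ ℤ.+ 0
T₄-short = mon-zero 1 2 2 1 (CgfAtQjV 1) 0 (CgfAtQjV-empty 1)

T₅-short : ∀ n → n < 3 → ∀ s a c → T₅ n s a c ≡ ℤ.+ 0
T₅-short 0 _ = divOneMinusQV-zero (mon 2 3 5 2 (CgfAtQjV 2)) 0 (λ _ _ _ → refl)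
T₅-short 1 _ = divOneMinusQV-zero (mon 2 3 5 2 (CgfAtQjV 2)) 1 (λ _ _ _ → refl)
T₅-short 2 _ = divOneMinusQV-zero (mon 2 3 5 2 (CgfAtQjV 2)) 2 (mon-zero 2 3 5 2 (CgfAtQjV 2) 0 (CgfAtQjV-empty 2))
T₅-short (suc (suc (suc _))) (s≤s (s≤s (s≤s ())))

-- Per prefix u, T₃ - T₅ contributes the weights of the words u (L + 1) x with x ≤ L + 1.
T₃-long : ∀ n s a c → T₃ (3 + n) s a c ≡ ℤ.+ (peakTerm (suc n) s a c + correctionTerm (suc n) s a c)
T₃-long n s a c =
  trans (divOneMinusQV-∑avoiders (mon 2 3 3 0 CgfAtQ) (3 + n) (suc n) _ (mon-CgfAtQ-coeff 2 3 3 0 n) s a c)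
        (cong ℤ.+_ (trans (∑avoiders-cong (suc n) (λ u → geomQV-peaks (sper u) (area u) (lastLetter u) s a c))
                          (∑avoiders-+ (suc n) _ _)))

T₄-long : ∀ n s a c → T₄ (2 + n) s a c ≡ ℤ.+ ascentTerm (suc n) s a c
T₄-long = mon-CgfAtQjV-coeff 1 2 2 1 1

T₄-2 : ∀ s a c → T₄ 2 s a c ≡ ℤ.+ mono 4 3 1 s a c
T₄-2 s a c = trans (T₄-long 0 s a c) (cong ℤ.+_ (∑avoidersBelow-1 ascent ≤-refl))
  where
  ascent : List ℕ → ℕ
  ascent u = mono (2 + sper u) (2 + (1 * lastLetter u + area u)) (1 + lastLetter u) s a c

T₅-long : ∀ n s a c → T₅ (3 + n) s a c ≡ ℤ.+ correctionTerm (suc n) s a c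
T₅-long n = divOneMinusQV-∑avoiders (mon 2 3 5 2 (CgfAtQjV 2)) (3 + n) (suc n) _ (mon-CgfAtQjV-coeff 2 3 5 2 2 n)

Cgf-1 : ∀ s a c → Cgf 1 s a c ≡ ℤ.+ mono 2 1 0 s a c
Cgf-1 s a c = trans (Ci-coeff c 0 s a) (cong ℤ.+_ (∑avoidersBelow-1 (λ w → weight w s a c) ≤-refl))

Cgf-2 : ∀ s a c → Cgf 2 s a c ≡ ℤ.+ (mono 3 2 0 s a c + mono 4 3 1 s a c)
Cgf-2 s a c = begin
  Cgf 2 s a c                                          ≡⟨ Ci-coeff c 1 s a ⟩
  ℤ.+ ∑avoiders 2 g                                    ≡⟨ cong ℤ.+_ (∑avoiders-∷ʳ 0 g) ⟩
  ℤ.+ ∑avoiders 1 (∑extensions g)                      ≡⟨ cong ℤ.+_ (∑avoidersBelow-1 (∑extensions g) ≤-refl) ⟩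
  ℤ.+ (mono 4 3 1 s a c + 1 * (0 + mono 3 2 0 s a c))  ≡⟨ cong ℤ.+_ (solve 2 (λ x y → x :+ con 1 :* (con 0 :+ y) := y :+ x)
                                                                            refl (mono 4 3 1 s a c) (mono 3 2 0 s a c)) ⟩
  ℤ.+ (mono 3 2 0 s a c + mono 4 3 1 s a c)            ∎
  where
  open ≡-Reasoning
  g : List ℕ → ℕ
  g w = weight w s a c

Cgf-long : ∀ k s a c → Cgf (3 + k) s a c ≡ ℤ.+ (ascentTerm (2 + k) s a c + peakTerm (1 + k) s a c)
Cgf-long k s a c = begin
  Cgf (3 + k) s a c
    ≡⟨ Ci-coeff c (2 + k) s a ⟩
  ℤ.+ ∑avoiders (3 + k) (λ w → weight w s a c)
    ≡⟨ cong ℤ.+_ (∑avoiders-split k (λ w → weight w s a c)) ⟩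
  ℤ.+ (∑avoiders (2 + k) (λ u → weight (u ∷ʳ suc (lastLetter u)) s a c) +
       ∑avoiders (1 + k) (λ u → ∑[ x < 2 + lastLetter u ] weight ((u ∷ʳ suc (lastLetter u)) ∷ʳ x) s a c))
    ≡⟨ cong ℤ.+_ (cong₂ _+_ (∑avoiders-cong⁺ (suc k) (λ x r → cong (λ F → F s a c) (weight-ascent x r)))
                            (∑avoiders-cong⁺ k (λ x r → ∑<-cong _ (λ y y< → cong (λ F → F s a c) (weight-peak x r y y<))))) ⟩
  ℤ.+ (ascentTerm (2 + k) s a c + peakTerm (1 + k) s a c)
    ∎
  where open ≡-Reasoning

theorem2p1 : ∀ (n s a c : ℕ) →
    Cgf n s a c ≡
      ( monomial 1 2 1 0
      ⊕ monomial 2 3 2 0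
      ⊕ divOneMinusQV (mon 2 3 3 0 CgfAtQ)
      ⊕ mon 1 2 2 1 (CgfAtQjV 1)
      ⊖ divOneMinusQV (mon 2 3 5 2 (CgfAtQjV 2)) ) n s a c
theorem2p1 0 s a c =
  sym (sum-minus-pos {x₁ = 0} {0} {0} {0} {0} refl refl (T₃-short 0 z<s s a c) refl (T₅-short 0 z<s s a c))
theorem2p1 1 s a c = begin
  Cgf 1 s a c
    ≡⟨ Cgf-1 s a c ⟩
  ℤ.+ mono 2 1 0 s a c
    ≡⟨ cong ℤ.+_ (solve 1 (λ m → m := m :+ con 0 :+ con 0 :+ con 0) refl _) ⟩
  ℤ.+ (mono 2 1 0 s a c + 0 + 0 + 0)
    ≡⟨ sum-minus-pos (monomial-coeff 1 2 1 0 s a c) refl (T₃-short 1 (s<s z<s) s a c)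
                     (T₄-short s a c) (T₅-short 1 (s<s z<s) s a c) ⟨
  _ ∎
  where open ≡-Reasoning
theorem2p1 2 s a c = begin
  Cgf 2 s a c
    ≡⟨ Cgf-2 s a c ⟩
  ℤ.+ (mono 3 2 0 s a c + mono 4 3 1 s a c)
    ≡⟨ cong ℤ.+_ (cong (_+ mono 4 3 1 s a c) (sym (+-identityʳ (mono 3 2 0 s a c)))) ⟩
  ℤ.+ (0 + mono 3 2 0 s a c + 0 + mono 4 3 1 s a c)
    ≡⟨ sum-minus-pos (monomial-zero 1 2 1 0 0 s a c) (monomial-coeff 2 3 2 0 s a c) (T₃-short 2 ≤-refl s a c)
                     (T₄-2 s a c) (T₅-short 2 ≤-refl s a c) ⟨
  _ ∎
  where open ≡-Reasoning
theorem2p1 (suc (suc (suc k))) s a c = begin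
  Cgf (3 + k) s a c
    ≡⟨ Cgf-long k s a c ⟩
  ℤ.+ (ascentTerm (2 + k) s a c + peakTerm (1 + k) s a c)
    ≡⟨ cong ℤ.+_ (+-comm (ascentTerm (2 + k) s a c) _) ⟩
  ℤ.+ (0 + 0 + peakTerm (1 + k) s a c + ascentTerm (2 + k) s a c)
    ≡⟨ sum-minus-pos (monomial-zero 1 2 1 0 (suc k) s a c) (monomial-zero 2 3 2 0 k s a c)
                     (T₃-long k s a c) (T₄-long (suc k) s a c) (T₅-long k s a c) ⟨
  _ ∎
  where open ≡-Reasoning
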